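{- If a formula $A$ is valid in every neighbourhood model satisfying centering, then for a world label $x$ the sequent $\Rightarrow x:A$ is derivable in the labelled calculus $\mathbf{CL^C}$.
   Context: Formulas: built from atoms and $\bot$ by $\wedge,\vee,\rightarrow,>$. Neighbourhood model $\langle W,N,\llbracket\cdot\rrbracket\rangle$: $W\neq\emptyset$, $N:W\to\mathcal{P}(\mathcal{P}(W))$ with every member of every $N(x)$ non-empty, valuation of atoms. Forcing: atoms via valuation, $\bot$ never, Boolean classically; $x\Vdash A>B$ iff for every $\alpha\in N(x)$ containing a world forcing $A$ there is $\beta\in N(x)$ with $\beta\subseteq\alpha$, some world of $\beta$ forcing $A$, and all worlds of $\beta$ forcing $A\rightarrow B$. Valid = forced at every world. Centering: for all $x\in W$ and $\alpha\in N(x)$, $x\in\alpha$, and $\{x\}\in N(x)$. Labelled calculi: world labels $x,y,z,\dots$, neighbourhood labels $a,b,c,\dots$ and $\{x\}$ for each world label $x$; relational atoms $a\in N(x)$, $x\in a$, $a\subseteq b$; labelled formulas: relational atoms, $x:A$, $a\Vdash^\exists A$, $a\Vdash^\forall A$, $x\Vdash_a A|B$; sequents $\Gamma\Rightarrow\Delta$ of multisets, relational atoms only in $\Gamma$. Rules premiss(es) / conclusion; "($u$ fresh)": $u$ not in conclusion. $\mathbf{CL}$: initial sequents $x:p,\Gamma\Rightarrow\Delta,x:p$ ($p$ atom), $x:\bot,\Gamma\Rightarrow\Delta$; L$\wedge$: $x:A,x:B,\Gamma\Rightarrow\Delta$ / $x:A\wedge B,\Gamma\Rightarrow\Delta$;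 R$\wedge$: $\Gamma\Rightarrow\Delta,x:A$ and $\Gamma\Rightarrow\Delta,x:B$ / $\Gamma\Rightarrow\Delta,x:A\wedge B$; L$\vee$: $x:A,\Gamma\Rightarrow\Delta$ and $x:B,\Gamma\Rightarrow\Delta$ / $x:A\vee B,\Gamma\Rightarrow\Delta$; R$\vee$: $\Gamma\Rightarrow\Delta,x:A,x:B$ / $\Gamma\Rightarrow\Delta,x:A\vee B$; L$\rightarrow$: $\Gamma\Rightarrow\Delta,x:A$ and $x:B,\Gamma\Rightarrow\Delta$ / $x:A\rightarrow B,\Gamma\Rightarrow\Delta$; R$\rightarrow$: $x:A,\Gamma\Rightarrow\Delta,x:B$ / $\Gamma\Rightarrow\Delta,x:A\rightarrow B$; L$\forall$: $x:A,x\in a,a\Vdash^\forall A,\Gamma\Rightarrow\Delta$ / $x\in a,a\Vdash^\forall A,\Gamma\Rightarrow\Delta$; R$\forall$ ($x$ fresh): $x\in a,\Gamma\Rightarrow\Delta,x:A$ / $\Gamma\Rightarrow\Delta,a\Vdash^\forall A$; L$\exists$ ($x$ fresh): $x\in a,x:A,\Gamma\Rightarrow\Delta$ / $a\Vdash^\exists A,\Gamma\Rightarrow\Delta$; R$\exists$: $x\in a,\Gamma\Rightarrow\Delta,x:A,a\Vdash^\exists A$ / $x\in a,\Gamma\Rightarrow\Delta,a\Vdash^\exists A$; R$>$ ($a$ fresh): $a\in N(x),a\Vdash^\exists A,\Gamma\Rightarrow\Delta,x\Vdash_a A|B$ / $\Gamma\Rightarrow\Delta,x:A>B$; L$>$: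 $a\in N(x),x:A>B,\Gamma\Rightarrow\Delta,a\Vdash^\exists A$ and $x\Vdash_a A|B,a\in N(x),x:A>B,\Gamma\Rightarrow\Delta$ / $a\in N(x),x:A>B,\Gamma\Rightarrow\Delta$; R$|$: $c\in N(x),c\subseteq a,\Gamma\Rightarrow\Delta,x\Vdash_a A|B,c\Vdash^\exists A$ and $c\in N(x),c\subseteq a,\Gamma\Rightarrow\Delta,x\Vdash_a A|B,c\Vdash^\forall A\rightarrow B$ / $c\in N(x),c\subseteq a,\Gamma\Rightarrow\Delta,x\Vdash_a A|B$; L$|$ ($c$ fresh): $c\in N(x),c\subseteq a,c\Vdash^\exists A,c\Vdash^\forall A\rightarrow B,\Gamma\Rightarrow\Delta$ / $x\Vdash_a A|B,\Gamma\Rightarrow\Delta$; Ref: $a\subseteq a,\Gamma\Rightarrow\Delta$ / $\Gamma\Rightarrow\Delta$; Tr: $c\subseteq a,c\subseteq b,b\subseteq a,\Gamma\Rightarrow\Delta$ / $c\subseteq b,b\subseteq a,\Gamma\Rightarrow\Delta$; L$\subseteq$: $x\in a,a\subseteq b,x\in b,\Gamma\Rightarrow\Delta$ / $x\in a,a\subseteq b,\Gamma\Rightarrow\Delta$. $\mathbf{CL^C}$ is $\mathbf{CL}$ plus: N ($a$ fresh): $a\in N(x),\Gamma\Rightarrow\Delta$ / $\Gamma\Rightarrow\Delta$; 0 ($y$ fresh): $y\in a,a\in N(x),\Gamma\Rightarrow\Delta$ / $a\in N(x),\Gamma\Rightarrow\Delta$; T ($a$ fresh): $x\in a,a\in N(x),\Gamma\Rightarrow\Delta$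 / $\Gamma\Rightarrow\Delta$; W: $x\in a,a\in N(x),\Gamma\Rightarrow\Delta$ / $a\in N(x),\Gamma\Rightarrow\Delta$; Single: $x\in\{x\},\{x\}\in N(x),\Gamma\Rightarrow\Delta$ / $\{x\}\in N(x),\Gamma\Rightarrow\Delta$; C: $\{x\}\in N(x),\{x\}\subseteq a,a\in N(x),\Gamma\Rightarrow\Delta$ / $a\in N(x),\Gamma\Rightarrow\Delta$; Repl$_1$: $y\in\{x\},At(x),At(y),\Gamma\Rightarrow\Delta$ / $y\in\{x\},At(x),\Gamma\Rightarrow\Delta$; Repl$_2$: $y\in\{x\},At(x),At(y),\Gamma\Rightarrow\Delta$ / $y\in\{x\},At(y),\Gamma\Rightarrow\Delta$, where $At(x)$ is one of $x:P$ ($P$ atom), $x\in a$, $a\in N(x)$, $x\in\{z\}$, and $At(y)$ is obtained by replacing $x$ by $y$. -}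

module Defs where

open import Level using (Level; Lift; 0ℓ) renaming (suc to lsuc)
open import Data.Nat using (ℕ)
open import Data.Empty using (⊥)
open import Data.Product using (Σ; _×_; _,_)
open import Data.Sum using (_⊎_)
open import Data.List using (List; []; _∷_; [_]; _++_)
open import Data.List.Relation.Unary.All using (All)
open import Data.List.Relation.Binary.Permutation.Propositional using (_↭_)
open import Relation.Nullary using (¬_)
open import Relation.Binary.PropositionalEquality using (_≡_)

data Fm : Set where
  atom : ℕ → Fm
  ⊥'   : Fm
  _∧'_ : Fm → Fm → Fm
  _∨'_ : Fm → Fm → Fm
  _⇒'_ : Fm → Fm → Fm
  _>'_ : Fm → Fm → Fm

-- Neighbourhood models.  Sets of worlds are predicates W → Set;
-- N x α means α ∈ N(x).

record NModel : Set₁ where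
  field
    W        : Set
    inhabited : W
    N        : W → (W → Set) → Set
    nonempty : ∀ x α → N x α → Σ W α
    V        : ℕ → W → Set

module _ (M : NModel) where
  open NModel M

  _⊆w_ : (W → Set) → (W → Set) → Set
  β ⊆w α = ∀ w → β w → α w

  _⊩_ : W → Fm → Set₁
  x ⊩ atom p   = Lift (lsuc 0ℓ) (V p x)
  x ⊩ ⊥'       = Lift (lsuc 0ℓ) ⊥
  x ⊩ (A ∧' B) = (x ⊩ A) × (x ⊩ B)
  x ⊩ (A ∨' B) = (x ⊩ A) ⊎ (x ⊩ B)
  x ⊩ (A ⇒' B) = (x ⊩ A) → (x ⊩ B)
  x ⊩ (A >' B) =
    ∀ (α : W → Set) → N x α → Σ W (λ w → α w × (w ⊩ A)) →
      Σ (W → Set) (λ β → N x β × (β ⊆w α)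
        × Σ W (λ w → β w × (w ⊩ A))
        × (∀ w → β w → (w ⊩ A) → (w ⊩ B)))

  Centered : Set₁
  Centered = (∀ x α → N x α → α x) × (∀ x → N x (λ w → w ≡ x))

ValidC : Fm → Set₁
ValidC A = ∀ (M : NModel) → Centered M → ∀ (x : NModel.W M) → _⊩_ M x A

WL : Set
WL = ℕ

data NL : Set where
  nb   : ℕ → NL
  sing : WL → NL         -- the label {x}

data LF : Set where
  _∈N_      : NL → WL → LF
  _∈ₗ_      : WL → NL → LF
  _⊆ₗ_      : NL → NL → LF
  _∶_       : WL → Fm → LF
  _⊩∃_      : NL → Fm → LF
  _⊩∀_      : NL → Fm → LF
  _⊩[_]_∣_  : WL → NL → Fm → Fm → LF

wInNL : WL → NL → Set
wInNL y (nb _)   = ⊥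
wInNL y (sing z) = y ≡ z

wOcc : WL → LF → Set
wOcc y (a ∈N x)         = wInNL y a ⊎ y ≡ x
wOcc y (x ∈ₗ a)         = y ≡ x ⊎ wInNL y a
wOcc y (a ⊆ₗ b)         = wInNL y a ⊎ wInNL y b
wOcc y (x ∶ A)          = y ≡ x
wOcc y (a ⊩∃ A)         = wInNL y a
wOcc y (a ⊩∀ A)         = wInNL y a
wOcc y (x ⊩[ a ] A ∣ B) = y ≡ x ⊎ wInNL y a

nOcc : ℕ → LF → Set
nOcc n (a ∈N x)         = nb n ≡ a
nOcc n (x ∈ₗ a)         = nb n ≡ a
nOcc n (a ⊆ₗ b)         = nb n ≡ a ⊎ nb n ≡ b
nOcc n (x ∶ A)          = ⊥
nOcc n (a ⊩∃ A)         = nb n ≡ a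
nOcc n (a ⊩∀ A)         = nb n ≡ a
nOcc n (x ⊩[ a ] A ∣ B) = nb n ≡ a

-- freshness w.r.t. a sequent Γ ⇒ Δ (the conclusion of a rule)
FreshW : WL → List LF → List LF → Set
FreshW y Γ Δ = All (λ φ → ¬ wOcc y φ) (Γ ++ Δ)

FreshN : ℕ → List LF → List LF → Set
FreshN n Γ Δ = All (λ φ → ¬ nOcc n φ) (Γ ++ Δ)

-- atomic schemata At(·) for Repl: x:P, x ∈ a, a ∈ N(x), x ∈ {z};
-- the distinguished world position is the argument.
data AtS : Set where
  atP    : ℕ → AtS
  atIn   : NL → AtS
  atN    : NL → AtS
  atSing : WL → AtS

at : AtS → WL → LF
at (atP p)    x = x ∶ atom p
at (atIn a)   x = x ∈ₗ a
at (atN a)    x = a ∈N x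
at (atSing z) x = x ∈ₗ sing z

-- The calculus CL^C.  Sequents Γ ⇒ Δ are pairs of lists considered up to
-- permutation (rule perm), i.e. multisets.

infix 3 _⇒_

data _⇒_ : List LF → List LF → Set where
  perm : ∀ {Γ Δ Γ' Δ'} → Γ ⇒ Δ → Γ ↭ Γ' → Δ ↭ Δ' → Γ' ⇒ Δ'
  init  : ∀ {Γ Δ x p} → (x ∶ atom p ∷ Γ) ⇒ (x ∶ atom p ∷ Δ)
  init⊥ : ∀ {Γ Δ x} → (x ∶ ⊥' ∷ Γ) ⇒ Δ
  L∧ : ∀ {Γ Δ x A B} → (x ∶ A ∷ x ∶ B ∷ Γ) ⇒ Δ → (x ∶ (A ∧' B) ∷ Γ) ⇒ Δ
  R∧ : ∀ {Γ Δ x A B} → Γ ⇒ (x ∶ A ∷ Δ) → Γ ⇒ (x ∶ B ∷ Δ) → Γ ⇒ (x ∶ (A ∧' B) ∷ Δ)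
  L∨ : ∀ {Γ Δ x A B} → (x ∶ A ∷ Γ) ⇒ Δ → (x ∶ B ∷ Γ) ⇒ Δ → (x ∶ (A ∨' B) ∷ Γ) ⇒ Δ
  R∨ : ∀ {Γ Δ x A B} → Γ ⇒ (x ∶ A ∷ x ∶ B ∷ Δ) → Γ ⇒ (x ∶ (A ∨' B) ∷ Δ)
  L⇒ : ∀ {Γ Δ x A B} → Γ ⇒ (x ∶ A ∷ Δ) → (x ∶ B ∷ Γ) ⇒ Δ → (x ∶ (A ⇒' B) ∷ Γ) ⇒ Δ
  R⇒ : ∀ {Γ Δ x A B} → (x ∶ A ∷ Γ) ⇒ (x ∶ B ∷ Δ) → Γ ⇒ (x ∶ (A ⇒' B) ∷ Δ)
  L∀ : ∀ {Γ Δ x a A} → (x ∶ A ∷ x ∈ₗ a ∷ a ⊩∀ A ∷ Γ) ⇒ Δ → (x ∈ₗ a ∷ a ⊩∀ A ∷ Γ) ⇒ Δ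
  R∀ : ∀ {Γ Δ x a A} → FreshW x Γ (a ⊩∀ A ∷ Δ) →
       (x ∈ₗ a ∷ Γ) ⇒ (x ∶ A ∷ Δ) → Γ ⇒ (a ⊩∀ A ∷ Δ)
  L∃ : ∀ {Γ Δ x a A} → FreshW x (a ⊩∃ A ∷ Γ) Δ →
       (x ∈ₗ a ∷ x ∶ A ∷ Γ) ⇒ Δ → (a ⊩∃ A ∷ Γ) ⇒ Δ
  R∃ : ∀ {Γ Δ x a A} → (x ∈ₗ a ∷ Γ) ⇒ (x ∶ A ∷ a ⊩∃ A ∷ Δ) → (x ∈ₗ a ∷ Γ) ⇒ (a ⊩∃ A ∷ Δ)
  R> : ∀ {Γ Δ x A B n} → FreshN n Γ (x ∶ (A >' B) ∷ Δ) →
       (nb n ∈N x ∷ nb n ⊩∃ A ∷ Γ) ⇒ (x ⊩[ nb n ] A ∣ B ∷ Δ) → Γ ⇒ (x ∶ (A >' B) ∷ Δ)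
  L> : ∀ {Γ Δ x a A B} → (a ∈N x ∷ x ∶ (A >' B) ∷ Γ) ⇒ (a ⊩∃ A ∷ Δ) →
       (x ⊩[ a ] A ∣ B ∷ a ∈N x ∷ x ∶ (A >' B) ∷ Γ) ⇒ Δ →
       (a ∈N x ∷ x ∶ (A >' B) ∷ Γ) ⇒ Δ
  R∣ : ∀ {Γ Δ x a c A B} →
       (c ∈N x ∷ c ⊆ₗ a ∷ Γ) ⇒ (x ⊩[ a ] A ∣ B ∷ c ⊩∃ A ∷ Δ) →
       (c ∈N x ∷ c ⊆ₗ a ∷ Γ) ⇒ (x ⊩[ a ] A ∣ B ∷ c ⊩∀ (A ⇒' B) ∷ Δ) →
       (c ∈N x ∷ c ⊆ₗ a ∷ Γ) ⇒ (x ⊩[ a ] A ∣ B ∷ Δ)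
  L∣ : ∀ {Γ Δ x a A B n} → FreshN n (x ⊩[ a ] A ∣ B ∷ Γ) Δ →
       (nb n ∈N x ∷ nb n ⊆ₗ a ∷ nb n ⊩∃ A ∷ nb n ⊩∀ (A ⇒' B) ∷ Γ) ⇒ Δ →
       (x ⊩[ a ] A ∣ B ∷ Γ) ⇒ Δ
  Ref : ∀ {Γ Δ a} → (a ⊆ₗ a ∷ Γ) ⇒ Δ → Γ ⇒ Δ
  Tr  : ∀ {Γ Δ a b c} → (c ⊆ₗ a ∷ c ⊆ₗ b ∷ b ⊆ₗ a ∷ Γ) ⇒ Δ → (c ⊆ₗ b ∷ b ⊆ₗ a ∷ Γ) ⇒ Δ
  L⊆  : ∀ {Γ Δ x a b} → (x ∈ₗ a ∷ a ⊆ₗ b ∷ x ∈ₗ b ∷ Γ) ⇒ Δ → (x ∈ₗ a ∷ a ⊆ₗ b ∷ Γ) ⇒ Δ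
  RN  : ∀ {Γ Δ x n} → FreshN n Γ Δ → (nb n ∈N x ∷ Γ) ⇒ Δ → Γ ⇒ Δ
  R0  : ∀ {Γ Δ x y a} → FreshW y (a ∈N x ∷ Γ) Δ →
        (y ∈ₗ a ∷ a ∈N x ∷ Γ) ⇒ Δ → (a ∈N x ∷ Γ) ⇒ Δ
  RT  : ∀ {Γ Δ x n} → FreshN n Γ Δ → (x ∈ₗ nb n ∷ nb n ∈N x ∷ Γ) ⇒ Δ → Γ ⇒ Δ
  RW  : ∀ {Γ Δ x a} → (x ∈ₗ a ∷ a ∈N x ∷ Γ) ⇒ Δ → (a ∈N x ∷ Γ) ⇒ Δ
  Single : ∀ {Γ Δ x} → (x ∈ₗ sing x ∷ sing x ∈N x ∷ Γ) ⇒ Δ → (sing x ∈N x ∷ Γ) ⇒ Δ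
  RC  : ∀ {Γ Δ x a} → (sing x ∈N x ∷ sing x ⊆ₗ a ∷ a ∈N x ∷ Γ) ⇒ Δ → (a ∈N x ∷ Γ) ⇒ Δ
  Repl₁ : ∀ {Γ Δ x y} (t : AtS) →
          (y ∈ₗ sing x ∷ at t x ∷ at t y ∷ Γ) ⇒ Δ → (y ∈ₗ sing x ∷ at t x ∷ Γ) ⇒ Δ
  Repl₂ : ∀ {Γ Δ x y} (t : AtS) →
          (y ∈ₗ sing x ∷ at t x ∷ at t y ∷ Γ) ⇒ Δ → (y ∈ₗ sing x ∷ at t y ∷ Γ) ⇒ Δ

module Submission where

-- Suppose ⇒ x:A is not derivable.  Using excluded middle we follow an infinite branch of
-- backward proof search on which every sequent is underivable.  The rules are applied in a
-- fair order, so the formulas Γ occurring in the antecedents and Δ occurring in the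
-- succedents along the branch are closed under every rule of CL^C, and no x:p lies in both.
-- Γ describes a centred neighbourhood model: worlds are world labels up to y ∈ {x}, and the
-- neighbourhoods of x are named by the labels a with a ∈ N(x) in Γ.  By induction on
-- formulas, B is forced at the world of y when y:B lies in Γ and fails there when y:B lies
-- in Δ; as x:A lies in Δ, A is not valid.

open import Defs
open import Level using (0ℓ; Lift; lift; lower) renaming (suc to lsuc)
open import Axiom.ExcludedMiddle using (ExcludedMiddle)
open import Function using (_∘_)
open import Data.Empty using (⊥; ⊥-elim)
open import Data.Maybe using (Maybe; just; nothing)
import Data.Maybe.Properties as Maybe
open import Data.Nat using (ℕ; zero; suc; _≤_; _<_; _≤′_; ≤′-reflexive; ≤′-step; _+_; _⊔_; z≤n; s≤s; _≟_)
open import Data.Nat.Properties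
  using (≤-refl; ≤-trans; ≤-<-trans; <⇒≱; m≤m⊔n; m≤n⊔m; +-suc; +-identityʳ; +-comm; ≤⇒≤′; ≤-antisym; m≤n⇒∃[o]m+o≡n)
open import Data.Product using (Σ; ∃; ∃₂; _×_; _,_; proj₁; proj₂)
open import Data.Sum using (_⊎_; inj₁; inj₂; [_,_]′)
import Data.Sum as Sum
open import Data.List using (List; []; _∷_; [_]; _++_; map; foldr; length; catMaybes)
open import Data.List.Membership.Propositional using (_∈_; _∉_; find)
open import Data.List.Membership.DecPropositional _≟_ using (_∈?_)
open import Data.List.Relation.Unary.All using (All; []; _∷_)
import Data.List.Relation.Unary.All as All
open import Data.List.Relation.Unary.All.Properties using (¬All⇒Any¬)
open import Data.List.Relation.Unary.Any using (here; there)
open import Data.List.Relation.Unary.AllPairs using ([]; _∷_)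
open import Data.List.Relation.Unary.Unique.Propositional using (Unique)
open import Data.List.Relation.Binary.Pointwise using (Pointwise; []; _∷_)
open import Data.List.Relation.Binary.Permutation.Propositional
  using (_↭_; prep; swap; ↭-sym; ↭-trans) renaming (refl to ↭-refl)
open import Data.List.Relation.Binary.Permutation.Propositional.Properties
  using (All-resp-↭; ++-comm; ++⁺ˡ; ++⁺)
open import Relation.Nullary using (¬_; Dec; yes; no)
open import Relation.Unary using (_≐′_)
open import Relation.Binary.PropositionalEquality
  using (_≡_; _≢_; refl; sym; trans; cong; cong₂; subst; subst₂)

-- Formulas removed by a rule leave holes, so positions in a sequent never shift.

Slots : Set
Slots = List (Maybe LF)

infixl 5 _‼_
_‼_ : Slots → ℕ → Maybe (Maybe LF)
[]       ‼ _     = nothing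
(s ∷ ss) ‼ zero  = just s
(s ∷ ss) ‼ suc i = ss ‼ i

infix 4 _[_]≡_
_[_]≡_ : Slots → ℕ → LF → Set
G [ i ]≡ φ = G ‼ i ≡ just (just φ)

erase : ℕ → Slots → Slots
erase _       []       = []
erase zero    (_ ∷ ss) = nothing ∷ ss
erase (suc i) (s ∷ ss) = s ∷ erase i ss

eraseAll : List ℕ → Slots → Slots
eraseAll []       G = G
eraseAll (i ∷ is) G = eraseAll is (erase i G)

[]≡-functional : ∀ G {i φ ψ} → G [ i ]≡ φ → G [ i ]≡ ψ → φ ≡ ψ
[]≡-functional _ e e′ = Maybe.just-injective (Maybe.just-injective (trans (sym e) e′))

erase-‼ : ∀ G {i j} → i ≢ j → erase i G ‼ j ≡ G ‼ j
erase-‼ []      {_}     {_}     _   = refl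
erase-‼ (_ ∷ G) {zero}  {zero}  i≢j = ⊥-elim (i≢j refl)
erase-‼ (_ ∷ G) {zero}  {suc _} _   = refl
erase-‼ (_ ∷ G) {suc _} {zero}  _   = refl
erase-‼ (_ ∷ G) {suc _} {suc _} i≢j = erase-‼ G (i≢j ∘ cong suc)

eraseAll-‼ : ∀ is G {j} → j ∉ is → eraseAll is G ‼ j ≡ G ‼ j
eraseAll-‼ []       G _   = refl
eraseAll-‼ (i ∷ is) G j∉ =
  trans (eraseAll-‼ is (erase i G) (j∉ ∘ there)) (erase-‼ G (λ i≡j → j∉ (here (sym i≡j))))

‼-++ : ∀ G H {i s} → G ‼ i ≡ just s → (G ++ H) ‼ i ≡ just s
‼-++ (_ ∷ G) H {zero}  e = e
‼-++ (_ ∷ G) H {suc i} e = ‼-++ G H e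

appended-at : ∀ G {xs φ} → φ ∈ xs → ∃ λ i → (G ++ map just xs) [ i ]≡ φ
appended-at []      (here refl) = zero , refl
appended-at []      (there φ∈)  = let i , e = appended-at [] φ∈ in suc i , e
appended-at (_ ∷ G) φ∈          = let i , e = appended-at G φ∈ in suc i , e

catMaybes-++ : ∀ (G H : Slots) → catMaybes (G ++ H) ≡ catMaybes G ++ catMaybes H
catMaybes-++ []             H = refl
catMaybes-++ (nothing ∷ G)  H = catMaybes-++ G H
catMaybes-++ (just φ ∷ G)   H = cong (φ ∷_) (catMaybes-++ G H)

catMaybes-just : ∀ (xs : List LF) → catMaybes (map just xs) ≡ xs
catMaybes-just []       = refl
catMaybes-just (x ∷ xs) = cong (x ∷_) (catMaybes-just xs)

catMaybes-erase : ∀ G {i φ} → G [ i ]≡ φ → catMaybes G ↭ φ ∷ catMaybes (erase i G)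
catMaybes-erase (just _ ∷ G)  {zero}  refl = ↭-refl
catMaybes-erase (nothing ∷ G) {suc i} e    = catMaybes-erase G e
catMaybes-erase (just ψ ∷ G)  {suc i} e    = ↭-trans (prep ψ (catMaybes-erase G e)) (swap ψ _ ↭-refl)

erase-pointwise : ∀ G {i is Φ} → All (i ≢_) is →
                  Pointwise (G [_]≡_) is Φ → Pointwise (erase i G [_]≡_) is Φ
erase-pointwise G []           []       = []
erase-pointwise G (i≢j ∷ i≢js) (e ∷ es) = trans (erase-‼ G i≢j) e ∷ erase-pointwise G i≢js es

catMaybes-eraseAll : ∀ G {is Φ} → Unique is → Pointwise (G [_]≡_) is Φ →
                     catMaybes G ↭ Φ ++ catMaybes (eraseAll is G)
catMaybes-eraseAll G []         []       = ↭-refl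
catMaybes-eraseAll G (i≢ ∷ u)  (e ∷ es) =
  ↭-trans (catMaybes-erase G e) (prep _ (catMaybes-eraseAll (erase _ G) u (erase-pointwise G i≢ es)))

pointwise-functional : ∀ G {is} {Φ Ψ : List LF} → Pointwise (G [_]≡_) is Φ → Pointwise (G [_]≡_) is Ψ → Φ ≡ Ψ
pointwise-functional G []       []         = refl
pointwise-functional G (e ∷ es) (e′ ∷ es′) = cong₂ _∷_ ([]≡-functional G e e′) (pointwise-functional G es es′)

positions-distinct : ∀ G {i φ is} {Ψ : List LF} → G [ i ]≡ φ → All (φ ≢_) Ψ →
                     Pointwise (G [_]≡_) is Ψ → All (i ≢_) is
positions-distinct G e []           []         = []
positions-distinct G e (φ≢ψ ∷ φ≢Ψ) (e′ ∷ es′) =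
  (λ { refl → φ≢ψ ([]≡-functional G e e′) }) ∷ positions-distinct G e φ≢Ψ es′

positions-unique : ∀ G {is} {Φ : List LF} → Unique Φ → Pointwise (G [_]≡_) is Φ → Unique is
positions-unique G []         []       = []
positions-unique G (φ≢ ∷ u)  (e ∷ es) = positions-distinct G e φ≢ es ∷ positions-unique G u es

unique₁ : ∀ {φ : LF} → Unique [ φ ]
unique₁ = [] ∷ []

unique₂ : ∀ {φ ψ : LF} → φ ≢ ψ → Unique (φ ∷ ψ ∷ [])
unique₂ φ≢ψ = (φ≢ψ ∷ []) ∷ [] ∷ []

module LabelBound (Occurs : ℕ → LF → Set) (bound : LF → ℕ) (occurs-≤ : ∀ {y} φ → Occurs y φ → y ≤ bound φ) where

  maxBound : List LF → ℕ
  maxBound = foldr (λ φ m → bound φ ⊔ m) 0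

  above-fresh : ∀ Γ {y} → maxBound Γ < y → All (λ φ → ¬ Occurs y φ) Γ
  above-fresh []      _  = []
  above-fresh (φ ∷ Γ) lt =
    (λ o → <⇒≱ lt (≤-trans (occurs-≤ φ o) (m≤m⊔n _ _))) ∷ above-fresh Γ (≤-<-trans (m≤n⊔m (bound φ) _) lt)

worldOf : NL → ℕ
worldOf (nb _)   = 0
worldOf (sing z) = z

nbOf : NL → ℕ
nbOf (nb n)   = n
nbOf (sing _) = 0

worldBound : LF → ℕ
worldBound (a ∈N x)         = worldOf a ⊔ x
worldBound (x ∈ₗ a)         = x ⊔ worldOf a
worldBound (a ⊆ₗ b)         = worldOf a ⊔ worldOf b
worldBound (x ∶ _)          = x
worldBound (a ⊩∃ _)         = worldOf a
worldBound (a ⊩∀ _)         = worldOf a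
worldBound (x ⊩[ a ] _ ∣ _) = x ⊔ worldOf a

nbBound : LF → ℕ
nbBound (a ∈N _)         = nbOf a
nbBound (_ ∈ₗ a)         = nbOf a
nbBound (a ⊆ₗ b)         = nbOf a ⊔ nbOf b
nbBound (_ ∶ _)          = 0
nbBound (a ⊩∃ _)         = nbOf a
nbBound (a ⊩∀ _)         = nbOf a
nbBound (_ ⊩[ a ] _ ∣ _) = nbOf a

wInNL-≤ : ∀ {y} a → wInNL y a → y ≤ worldOf a
wInNL-≤ (sing _) refl = ≤-refl

nb≡-≤ : ∀ {n} a → nb n ≡ a → n ≤ nbOf a
nb≡-≤ _ refl = ≤-refl

wOcc-≤ : ∀ {y} φ → wOcc y φ → y ≤ worldBound φ
wOcc-≤ (a ∈N _)         (inj₁ o)    = ≤-trans (wInNL-≤ a o) (m≤m⊔n _ _)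
wOcc-≤ (_ ∈N _)         (inj₂ refl) = m≤n⊔m _ _
wOcc-≤ (_ ∈ₗ _)         (inj₁ refl) = m≤m⊔n _ _
wOcc-≤ (_ ∈ₗ a)         (inj₂ o)    = ≤-trans (wInNL-≤ a o) (m≤n⊔m _ _)
wOcc-≤ (a ⊆ₗ _)         (inj₁ o)    = ≤-trans (wInNL-≤ a o) (m≤m⊔n _ _)
wOcc-≤ (_ ⊆ₗ b)         (inj₂ o)    = ≤-trans (wInNL-≤ b o) (m≤n⊔m _ _)
wOcc-≤ (_ ∶ _)          refl        = ≤-refl
wOcc-≤ (a ⊩∃ _)         o           = wInNL-≤ a o
wOcc-≤ (a ⊩∀ _)         o           = wInNL-≤ a o
wOcc-≤ (_ ⊩[ _ ] _ ∣ _) (inj₁ refl) = m≤m⊔n _ _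
wOcc-≤ (_ ⊩[ a ] _ ∣ _) (inj₂ o)    = ≤-trans (wInNL-≤ a o) (m≤n⊔m _ _)

nOcc-≤ : ∀ {n} φ → nOcc n φ → n ≤ nbBound φ
nOcc-≤ (a ∈N _)         o        = nb≡-≤ a o
nOcc-≤ (_ ∈ₗ a)         o        = nb≡-≤ a o
nOcc-≤ (a ⊆ₗ _)         (inj₁ o) = ≤-trans (nb≡-≤ a o) (m≤m⊔n _ _)
nOcc-≤ (_ ⊆ₗ b)         (inj₂ o) = ≤-trans (nb≡-≤ b o) (m≤n⊔m _ _)
nOcc-≤ (a ⊩∃ _)         o        = nb≡-≤ a o
nOcc-≤ (a ⊩∀ _)         o        = nb≡-≤ a o
nOcc-≤ (_ ⊩[ a ] _ ∣ _) o        = nb≡-≤ a o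

module WorldLabels = LabelBound wOcc worldBound wOcc-≤
module NbLabels    = LabelBound nOcc nbBound nOcc-≤

freshWorld : List LF → WL
freshWorld Γ = suc (WorldLabels.maxBound Γ)

freshNb : List LF → ℕ
freshNb Γ = suc (NbLabels.maxBound Γ)

freshWorld-fresh : ∀ {Γ} Γ′ Δ → Γ ↭ Γ′ ++ Δ → FreshW (freshWorld Γ) Γ′ Δ
freshWorld-fresh {Γ} _ _ σ = All-resp-↭ σ (WorldLabels.above-fresh Γ ≤-refl)

freshNb-fresh : ∀ {Γ} Γ′ Δ → Γ ↭ Γ′ ++ Δ → FreshN (freshNb Γ) Γ′ Δ
freshNb-fresh {Γ} _ _ σ = All-resp-↭ σ (NbLabels.above-fresh Γ ≤-refl)

Premiss : Set
Premiss = List LF × List LF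

DerivableOver : List LF → List LF → Premiss → Set
DerivableOver Γ Δ (Γ⁺ , Δ⁺) = (Γ⁺ ++ Γ) ⇒ (Δ⁺ ++ Δ)

-- The premisses of the rule that removes φ, with y and n as the fresh labels.
leftPremisses : WL → ℕ → LF → Maybe (List Premiss)
leftPremisses y n (x ∶ (A ∧' B))   = just [ x ∶ A ∷ x ∶ B ∷ [] , [] ]
leftPremisses y n (x ∶ (A ∨' B))   = just ((x ∶ A ∷ [] , []) ∷ (x ∶ B ∷ [] , []) ∷ [])
leftPremisses y n (x ∶ (A ⇒' B))   = just (([] , x ∶ A ∷ []) ∷ (x ∶ B ∷ [] , []) ∷ [])
leftPremisses y n (a ⊩∃ A)         = just [ y ∈ₗ a ∷ y ∶ A ∷ [] , [] ]
leftPremisses y n (x ⊩[ a ] A ∣ B) =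
  just [ nb n ∈N x ∷ nb n ⊆ₗ a ∷ nb n ⊩∃ A ∷ nb n ⊩∀ (A ⇒' B) ∷ [] , [] ]
leftPremisses _ _ _                = nothing

rightPremisses : WL → ℕ → LF → Maybe (List Premiss)
rightPremisses y n (x ∶ (A ∧' B)) = just (([] , x ∶ A ∷ []) ∷ ([] , x ∶ B ∷ []) ∷ [])
rightPremisses y n (x ∶ (A ∨' B)) = just [ [] , x ∶ A ∷ x ∶ B ∷ [] ]
rightPremisses y n (x ∶ (A ⇒' B)) = just [ x ∶ A ∷ [] , x ∶ B ∷ [] ]
rightPremisses y n (x ∶ (A >' B)) = just [ nb n ∈N x ∷ nb n ⊩∃ A ∷ [] , x ⊩[ nb n ] A ∣ B ∷ [] ]
rightPremisses y n (a ⊩∀ A)       = just [ y ∈ₗ a ∷ [] , y ∶ A ∷ [] ]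
rightPremisses _ _ _              = nothing

leftPremisses-sound : ∀ {y n φ Γ Δ ps} → leftPremisses y n φ ≡ just ps →
                      FreshW y (φ ∷ Γ) Δ → FreshN n (φ ∷ Γ) Δ →
                      All (DerivableOver Γ Δ) ps → (φ ∷ Γ) ⇒ Δ
leftPremisses-sound {φ = _ ∶ (_ ∧' _)}   refl _  _  (d ∷ [])       = L∧ d
leftPremisses-sound {φ = _ ∶ (_ ∨' _)}   refl _  _  (d₁ ∷ d₂ ∷ []) = L∨ d₁ d₂
leftPremisses-sound {φ = _ ∶ (_ ⇒' _)}   refl _  _  (d₁ ∷ d₂ ∷ []) = L⇒ d₁ d₂
leftPremisses-sound {φ = _ ⊩∃ _}         refl fy _  (d ∷ [])       = L∃ fy d
leftPremisses-sound {φ = _ ⊩[ _ ] _ ∣ _} refl _  fn (d ∷ [])       = L∣ fn d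
leftPremisses-sound {φ = _ ∶ atom _}     ()
leftPremisses-sound {φ = _ ∶ ⊥'}         ()
leftPremisses-sound {φ = _ ∶ (_ >' _)}   ()
leftPremisses-sound {φ = _ ∈N _}         ()
leftPremisses-sound {φ = _ ∈ₗ _}         ()
leftPremisses-sound {φ = _ ⊆ₗ _}         ()
leftPremisses-sound {φ = _ ⊩∀ _}         ()

rightPremisses-sound : ∀ {y n ψ Γ Δ ps} → rightPremisses y n ψ ≡ just ps →
                       FreshW y Γ (ψ ∷ Δ) → FreshN n Γ (ψ ∷ Δ) →
                       All (DerivableOver Γ Δ) ps → Γ ⇒ (ψ ∷ Δ)
rightPremisses-sound {ψ = _ ∶ (_ ∧' _)} refl _  _  (d₁ ∷ d₂ ∷ []) = R∧ d₁ d₂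
rightPremisses-sound {ψ = _ ∶ (_ ∨' _)} refl _  _  (d ∷ [])       = R∨ d
rightPremisses-sound {ψ = _ ∶ (_ ⇒' _)} refl _  _  (d ∷ [])       = R⇒ d
rightPremisses-sound {ψ = _ ∶ (_ >' _)} refl _  fn (d ∷ [])       = R> fn d
rightPremisses-sound {ψ = _ ⊩∀ _}       refl fy _  (d ∷ [])       = R∀ fy d
rightPremisses-sound {ψ = _ ∶ atom _}     ()
rightPremisses-sound {ψ = _ ∶ ⊥'}         ()
rightPremisses-sound {ψ = _ ∈N _}         ()
rightPremisses-sound {ψ = _ ∈ₗ _}         ()
rightPremisses-sound {ψ = _ ⊆ₗ _}         ()
rightPremisses-sound {ψ = _ ⊩∃ _}         ()
rightPremisses-sound {ψ = _ ⊩[ _ ] _ ∣ _} ()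

PersistsL PersistsR : LF → Set
PersistsL φ = ∀ y n → leftPremisses y n φ ≡ nothing
PersistsR ψ = ∀ y n → rightPremisses y n ψ ≡ nothing

data Kind : Set where
  kL∀ kR∃ kL> kR∣ kTr kL⊆ kRepl₁ kRepl₂ kRef kW kC kSingle : Kind

data Applicable : Kind → List LF → List LF → Set where
  L∀     : ∀ {x a A} → Applicable kL∀ (x ∈ₗ a ∷ a ⊩∀ A ∷ []) []
  R∃     : ∀ {x a A} → Applicable kR∃ [ x ∈ₗ a ] [ a ⊩∃ A ]
  L>     : ∀ {x a A B} → Applicable kL> (a ∈N x ∷ x ∶ (A >' B) ∷ []) []
  R∣     : ∀ {x a c A B} → Applicable kR∣ (c ∈N x ∷ c ⊆ₗ a ∷ []) [ x ⊩[ a ] A ∣ B ]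
  Tr     : ∀ {a b c} → Applicable kTr (c ⊆ₗ b ∷ b ⊆ₗ a ∷ []) []
  L⊆     : ∀ {x a b} → Applicable kL⊆ (x ∈ₗ a ∷ a ⊆ₗ b ∷ []) []
  Repl₁  : ∀ {x y} t → Applicable kRepl₁ (y ∈ₗ sing x ∷ at t x ∷ []) []
  Repl₂  : ∀ {x y} t → Applicable kRepl₂ (y ∈ₗ sing x ∷ at t y ∷ []) []
  Ref    : ∀ {a x} → Applicable kRef [ a ∈N x ] []
  W      : ∀ {a x} → Applicable kW [ a ∈N x ] []
  C      : ∀ {a x} → Applicable kC [ a ∈N x ] []
  Single : ∀ {x} → Applicable kSingle [ sing x ∈N x ] []

moveTo : WL → LF → LF
moveTo y (_ ∶ A)  = y ∶ A
moveTo y (_ ∈ₗ a) = y ∈ₗ a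
moveTo y (a ∈N _) = a ∈N y
moveTo y φ        = φ

moveTo-at : ∀ t {x y} → moveTo y (at t x) ≡ at t y
moveTo-at (atP _)    = refl
moveTo-at (atIn _)   = refl
moveTo-at (atN _)    = refl
moveTo-at (atSing _) = refl

sing≡at⇒≡ : ∀ t {x y} → y ∈ₗ sing x ≡ at t x → y ≡ x
sing≡at⇒≡ (atIn _)   refl = refl
sing≡at⇒≡ (atSing _) refl = refl
sing≡at⇒≡ (atP _)    ()
sing≡at⇒≡ (atN _)    ()

sing≡at⇒at≡sing : ∀ t {x y} → y ∈ₗ sing x ≡ at t y → at t x ≡ x ∈ₗ sing x
sing≡at⇒at≡sing (atIn _)   refl = refl
sing≡at⇒at≡sing (atSing _) refl = refl
sing≡at⇒at≡sing (atP _)    ()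
sing≡at⇒at≡sing (atN _)    ()

-- The formulas added to the kept principals; side conditions are left to Applicable.
additions : Kind → List LF → List LF → List Premiss
additions kL∀    (x ∈ₗ _ ∷ _ ⊩∀ A ∷ [])         []                      = [ [ x ∶ A ] , [] ]
additions kR∃    (x ∈ₗ _ ∷ [])                  (_ ⊩∃ A ∷ [])           = [ [] , [ x ∶ A ] ]
additions kL>    (a ∈N _ ∷ x ∶ (A >' B) ∷ [])   []                      =
  ([] , [ a ⊩∃ A ]) ∷ ([ x ⊩[ a ] A ∣ B ] , []) ∷ []
additions kR∣    (c ∈N _ ∷ _ ∷ [])              (_ ⊩[ _ ] A ∣ B ∷ [])   =
  ([] , [ c ⊩∃ A ]) ∷ ([] , [ c ⊩∀ (A ⇒' B) ]) ∷ []
additions kTr    (c ⊆ₗ _ ∷ _ ⊆ₗ a ∷ [])         []                      = [ [ c ⊆ₗ a ] , [] ]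
additions kL⊆    (x ∈ₗ _ ∷ _ ⊆ₗ b ∷ [])         []                      = [ [ x ∈ₗ b ] , [] ]
additions kRepl₁ (y ∈ₗ _ ∷ φ ∷ [])              []                      = [ [ moveTo y φ ] , [] ]
additions kRepl₂ (_ ∈ₗ sing x ∷ φ ∷ [])         []                      = [ [ moveTo x φ ] , [] ]
additions kRef   (a ∈N _ ∷ [])                  []                      = [ [ a ⊆ₗ a ] , [] ]
additions kW     (a ∈N x ∷ [])                  []                      = [ [ x ∈ₗ a ] , [] ]
additions kC     (a ∈N x ∷ [])                  []                      = [ sing x ∈N x ∷ sing x ⊆ₗ a ∷ [] , [] ]
additions kSingle (_ ∈N x ∷ [])                 []                      = [ [ x ∈ₗ sing x ] , [] ]
additions _      _                              _                       = []

rotate : ∀ {φ ψ χ} {Γ : List LF} → (χ ∷ φ ∷ ψ ∷ Γ) ↭ (φ ∷ ψ ∷ χ ∷ Γ)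
rotate = ↭-trans (swap _ _ ↭-refl) (prep _ (swap _ _ ↭-refl))

replaceHead : ∀ {φ ψ Γ Δ} → φ ≡ ψ → (φ ∷ Γ) ⇒ Δ → (ψ ∷ Γ) ⇒ Δ
replaceHead refl d = d

applicable-sound : ∀ {k Ls Rs Γ Δ} → Applicable k Ls Rs →
                   All (DerivableOver (Ls ++ Γ) (Rs ++ Δ)) (additions k Ls Rs) → (Ls ++ Γ) ⇒ (Rs ++ Δ)
applicable-sound L∀        (d ∷ [])       = L∀ d
applicable-sound R∃        (d ∷ [])       = R∃ d
applicable-sound L>        (d₁ ∷ d₂ ∷ []) = L> d₁ d₂
applicable-sound R∣        (d₁ ∷ d₂ ∷ []) =
  R∣ (perm d₁ ↭-refl (swap _ _ ↭-refl)) (perm d₂ ↭-refl (swap _ _ ↭-refl))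
applicable-sound Tr        (d ∷ [])       = Tr d
applicable-sound L⊆        (d ∷ [])       = L⊆ (perm d rotate ↭-refl)
applicable-sound (Repl₁ t) (d ∷ [])       = Repl₁ t (perm (replaceHead (moveTo-at t) d) rotate ↭-refl)
applicable-sound (Repl₂ t) (d ∷ [])       = Repl₂ t (perm (replaceHead (moveTo-at t) d) (swap _ _ ↭-refl) ↭-refl)
applicable-sound Ref       (d ∷ [])       = Ref d
applicable-sound W         (d ∷ [])       = RW d
applicable-sound C         (d ∷ [])       = RC d
applicable-sound Single    (d ∷ [])       = Single d

at-persists : ∀ t {x} → PersistsL (at t x)
at-persists (atP _)    _ _ = refl
at-persists (atIn _)   _ _ = refl
at-persists (atN _)    _ _ = refl
at-persists (atSing _) _ _ = refl

applicable-persists : ∀ {k Ls Rs} → Applicable k Ls Rs → All PersistsL Ls × All PersistsR Rs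
applicable-persists L∀        = (λ _ _ → refl) ∷ (λ _ _ → refl) ∷ [] , []
applicable-persists R∃        = (λ _ _ → refl) ∷ [] , (λ _ _ → refl) ∷ []
applicable-persists L>        = (λ _ _ → refl) ∷ (λ _ _ → refl) ∷ [] , []
applicable-persists R∣        = (λ _ _ → refl) ∷ (λ _ _ → refl) ∷ [] , (λ _ _ → refl) ∷ []
applicable-persists Tr        = (λ _ _ → refl) ∷ (λ _ _ → refl) ∷ [] , []
applicable-persists L⊆        = (λ _ _ → refl) ∷ (λ _ _ → refl) ∷ [] , []
applicable-persists (Repl₁ t) = (λ _ _ → refl) ∷ at-persists t ∷ [] , []
applicable-persists (Repl₂ t) = (λ _ _ → refl) ∷ at-persists t ∷ [] , []
applicable-persists Ref       = (λ _ _ → refl) ∷ [] , []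
applicable-persists W         = (λ _ _ → refl) ∷ [] , []
applicable-persists C         = (λ _ _ → refl) ∷ [] , []
applicable-persists Single    = (λ _ _ → refl) ∷ [] , []

data Task : Set where
  reduceL reduceR  : ℕ → Task
  addNeighbourhood : WL → Task
  close            : Kind → List ℕ → List ℕ → Task

next : ℕ × ℕ → ℕ × ℕ
next (zero  , j) = suc j , zero
next (suc i , j) = i , suc j

unpair : ℕ → ℕ × ℕ
unpair zero    = 0 , 0
unpair (suc n) = next (unpair n)

unpair-walk : ∀ d {i j n} → unpair n ≡ (d + i , j) → unpair (d + n) ≡ (i , d + j)
unpair-walk zero            e = e
unpair-walk (suc d) {i} {j} {n} e =
  subst₂ (λ m k → unpair m ≡ (i , k)) (+-suc d n) (+-suc d j) (unpair-walk d (cong next e))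

unpair-diagonal : ∀ s → ∃ λ n → unpair n ≡ (s , 0)
unpair-diagonal zero    = 0 , refl
unpair-diagonal (suc s) =
  let n , e = unpair-diagonal s
      e₀    = subst (λ k → unpair n ≡ (k , 0)) (sym (+-identityʳ s)) e
  in  suc (s + n) , trans (cong next (unpair-walk s e₀)) (cong (λ k → suc k , 0) (+-identityʳ s))

unpair-surjective : ∀ i j → ∃ λ n → unpair n ≡ (i , j)
unpair-surjective i j =
  let n , e = unpair-diagonal (j + i)
  in  j + n , trans (unpair-walk j e) (cong (i ,_) (+-identityʳ j))

unpair-proj₂-≤ : ∀ n → proj₂ (unpair n) ≤ n
unpair-proj₂-≤ zero = z≤n
unpair-proj₂-≤ (suc n) with unpair n | unpair-proj₂-≤ n
... | zero  , _ | _   = z≤n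
... | suc _ , _ | j≤n = s≤s j≤n

decodeList′ : ℕ → ℕ → List ℕ
decodeList′ zero    _ = []
decodeList′ (suc l) r = proj₁ (unpair r) ∷ decodeList′ l (proj₂ (unpair r))

decodeList′-surjective : ∀ xs → ∃ λ r → decodeList′ (length xs) r ≡ xs
decodeList′-surjective []       = 0 , refl
decodeList′-surjective (x ∷ xs) =
  let r , e  = decodeList′-surjective xs
      n , e′ = unpair-surjective x r
  in  n , cong₂ _∷_ (cong proj₁ e′) (trans (cong (decodeList′ (length xs) ∘ proj₂) e′) e)

decodeList : ℕ → List ℕ
decodeList n = decodeList′ (proj₁ (unpair n)) (proj₂ (unpair n))

decodeList-surjective : ∀ xs → ∃ λ n → decodeList n ≡ xs
decodeList-surjective xs =
  let r , e  = decodeList′-surjective xs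
      n , e′ = unpair-surjective (length xs) r
  in  n , trans (cong (λ p → decodeList′ (proj₁ p) (proj₂ p)) e′) e

decodeKind : ℕ → Kind
decodeKind 0  = kL∀
decodeKind 1  = kR∃
decodeKind 2  = kL>
decodeKind 3  = kR∣
decodeKind 4  = kTr
decodeKind 5  = kL⊆
decodeKind 6  = kRepl₁
decodeKind 7  = kRepl₂
decodeKind 8  = kRef
decodeKind 9  = kW
decodeKind 10 = kC
decodeKind _  = kSingle

decodeKind-surjective : ∀ k → ∃ λ c → decodeKind c ≡ k
decodeKind-surjective kL∀     = 0  , refl
decodeKind-surjective kR∃     = 1  , refl
decodeKind-surjective kL>     = 2  , refl
decodeKind-surjective kR∣     = 3  , refl
decodeKind-surjective kTr     = 4  , refl
decodeKind-surjective kL⊆     = 5  , refl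
decodeKind-surjective kRepl₁  = 6  , refl
decodeKind-surjective kRepl₂  = 7  , refl
decodeKind-surjective kRef    = 8  , refl
decodeKind-surjective kW      = 9  , refl
decodeKind-surjective kC      = 10 , refl
decodeKind-surjective kSingle = 11 , refl

decodeTask′ : ℕ × ℕ → Task
decodeTask′ (0 , r)                 = reduceL r
decodeTask′ (1 , r)                 = reduceR r
decodeTask′ (2 , r)                 = addNeighbourhood r
decodeTask′ (suc (suc (suc c)) , r) =
  close (decodeKind c) (decodeList (proj₁ (unpair r))) (decodeList (proj₂ (unpair r)))

decodeTask : ℕ → Task
decodeTask = decodeTask′ ∘ unpair

decodeTask-surjective : ∀ t → ∃ λ n → decodeTask n ≡ t
decodeTask-surjective (reduceL r)          = let n , e = unpair-surjective 0 r in n , cong decodeTask′ e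
decodeTask-surjective (reduceR r)          = let n , e = unpair-surjective 1 r in n , cong decodeTask′ e
decodeTask-surjective (addNeighbourhood r) = let n , e = unpair-surjective 2 r in n , cong decodeTask′ e
decodeTask-surjective (close k ls rs)
  with decodeKind-surjective k | decodeList-surjective ls | decodeList-surjective rs
... | c , refl | a , refl | b , refl =
  let r , e  = unpair-surjective a b
      n , e′ = unpair-surjective (3 + c) r
  in  n , trans (cong decodeTask′ e′) (cong (λ p → close _ (decodeList (proj₁ p)) (decodeList (proj₂ p))) e)

-- Only the first component of unpair m names the task, and the second one is unbounded.
task : ℕ → Task
task m = decodeTask (proj₁ (unpair m))

task-infinitely-often : ∀ t k → ∃ λ m → k ≤ m × task m ≡ t
task-infinitely-often t k =
  let n , e  = decodeTask-surjective t
      m , e′ = unpair-surjective n k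
  in  m , subst (_≤ m) (cong proj₂ e′) (unpair-proj₂-≤ m) , trans (cong (decodeTask ∘ proj₁) e′) e

record State : Set where
  constructor _⊢_
  field
    left right : Slots
open State

Derivable : State → Set
Derivable (G ⊢ D) = catMaybes G ⇒ catMaybes D

labels : State → List LF
labels (G ⊢ D) = catMaybes G ++ catMaybes D

freshW : State → WL
freshW = freshWorld ∘ labels

freshN : State → ℕ
freshN = freshNb ∘ labels

extend : List ℕ → List ℕ → Premiss → State → State
extend el er (Γ⁺ , Δ⁺) (G ⊢ D) = (eraseAll el G ++ map just Γ⁺) ⊢ (eraseAll er D ++ map just Δ⁺)

prepend : ∀ xs {Γ Γ′ : List LF} → Γ ↭ Γ′ → Γ ++ xs ↭ xs ++ Γ′
prepend xs {Γ} σ = ↭-trans (++-comm Γ xs) (++⁺ˡ xs σ)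

catMaybes-appended : ∀ G (xs : List LF) → catMaybes (G ++ map just xs) ≡ catMaybes G ++ xs
catMaybes-appended G xs = trans (catMaybes-++ G (map just xs)) (cong (catMaybes G ++_) (catMaybes-just xs))

derivable-extend : ∀ el er S {Γ Δ} p →
                   catMaybes (eraseAll el (left S)) ↭ Γ → catMaybes (eraseAll er (right S)) ↭ Δ →
                   Derivable (extend el er p S) → DerivableOver Γ Δ p
derivable-extend el er (G ⊢ D) (Γ⁺ , Δ⁺) σ τ d =
  perm (subst₂ _⇒_ (catMaybes-appended (eraseAll el G) Γ⁺) (catMaybes-appended (eraseAll er D) Δ⁺) d)
       (prepend Γ⁺ σ) (prepend Δ⁺ τ)

ReducesL ReducesR : State → ℕ → List Premiss → Set
ReducesL S i ps = ∃ λ φ → left S [ i ]≡ φ × leftPremisses (freshW S) (freshN S) φ ≡ just ps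
ReducesR S i ps = ∃ λ ψ → right S [ i ]≡ ψ × rightPremisses (freshW S) (freshN S) ψ ≡ just ps

record Step (S : State) : Set where
  field
    erasedL erasedR : List ℕ
    premisses       : List Premiss
    sound           : All (λ p → Derivable (extend erasedL erasedR p S)) premisses → Derivable S
    erasedL-reduces : ∀ {i} → i ∈ erasedL → ReducesL S i premisses
    erasedR-reduces : ∀ {i} → i ∈ erasedR → ReducesR S i premisses
open Step

idle : ∀ S → Step S
idle S = record
  { erasedL = [] ; erasedR = [] ; premisses = [ [] , [] ]
  ; sound = λ { (d ∷ []) → derivable-extend [] [] S _ ↭-refl ↭-refl d }
  ; erasedL-reduces = λ () ; erasedR-reduces = λ () }

reduceLeftWith : ∀ S i φ → left S [ i ]≡ φ → (m : Maybe (List Premiss)) →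
                 leftPremisses (freshW S) (freshN S) φ ≡ m → Step S
reduceLeftWith S i φ e nothing   _  = idle S
reduceLeftWith S i φ e (just ps) e′ = record
  { erasedL = [ i ] ; erasedR = [] ; premisses = ps
  ; sound = λ ds → perm (leftPremisses-sound e′ (freshWorld-fresh Γ′ Δ σ′) (freshNb-fresh Γ′ Δ σ′)
                                             (All.map (derivable-extend [ i ] [] S _ ↭-refl ↭-refl) ds))
                        (↭-sym σ) ↭-refl
  ; erasedL-reduces = λ { (here refl) → φ , e , e′ } ; erasedR-reduces = λ () }
  where
    Γ′ = φ ∷ catMaybes (erase i (left S))
    Δ  = catMaybes (right S)
    σ  = catMaybes-erase (left S) e
    σ′ = ++⁺ σ (↭-refl {xs = Δ})

reduceLeft : ∀ S i s → left S ‼ i ≡ s → Step S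
reduceLeft S i (just (just φ)) e = reduceLeftWith S i φ e _ refl
reduceLeft S i _               _ = idle S

reduceRightWith : ∀ S i ψ → right S [ i ]≡ ψ → (m : Maybe (List Premiss)) →
                  rightPremisses (freshW S) (freshN S) ψ ≡ m → Step S
reduceRightWith S i ψ e nothing   _  = idle S
reduceRightWith S i ψ e (just ps) e′ = record
  { erasedL = [] ; erasedR = [ i ] ; premisses = ps
  ; sound = λ ds → perm (rightPremisses-sound e′ (freshWorld-fresh Γ Δ′ τ′) (freshNb-fresh Γ Δ′ τ′)
                                              (All.map (derivable-extend [] [ i ] S _ ↭-refl ↭-refl) ds))
                        ↭-refl (↭-sym τ)
  ; erasedL-reduces = λ () ; erasedR-reduces = λ { (here refl) → ψ , e , e′ } }
  where
    Γ  = catMaybes (left S)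
    Δ′ = ψ ∷ catMaybes (erase i (right S))
    τ  = catMaybes-erase (right S) e
    τ′ = ++⁺ (↭-refl {xs = Γ}) τ

reduceRight : ∀ S i s → right S ‼ i ≡ s → Step S
reduceRight S i (just (just ψ)) e = reduceRightWith S i ψ e _ refl
reduceRight S i _               _ = idle S

neighbourhoodStep : ∀ S → WL → Step S
neighbourhoodStep S x = record
  { erasedL = [] ; erasedR = [] ; premisses = [ [ nb (freshN S) ∈N x ] , [] ]
  ; sound = λ { (d ∷ []) → RN (freshNb-fresh (catMaybes (left S)) (catMaybes (right S)) ↭-refl)
                               (derivable-extend [] [] S _ ↭-refl ↭-refl d) }
  ; erasedL-reduces = λ () ; erasedR-reduces = λ () }

Instance : State → Kind → List ℕ → List ℕ → Set
Instance S k ls rs = Σ (List LF) λ Ls → Σ (List LF) λ Rs →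
  Pointwise (left S [_]≡_) ls Ls × Pointwise (right S [_]≡_) rs Rs × Unique ls × Unique rs × Applicable k Ls Rs

closePremisses : ∀ S k ls rs → Dec (Instance S k ls rs) → List Premiss
closePremisses S k ls rs (yes (Ls , Rs , _)) = additions k Ls Rs
closePremisses S k ls rs (no _)              = [ [] , [] ]

closeStep : ∀ S k ls rs → Dec (Instance S k ls rs) → Step S
closeStep S k ls rs i? = record
  { erasedL = [] ; erasedR = [] ; premisses = closePremisses S k ls rs i?
  ; sound = sound′ i?
  ; erasedL-reduces = λ () ; erasedR-reduces = λ () }
  where
    sound′ : (i? : Dec (Instance S k ls rs)) →
             All (λ p → Derivable (extend [] [] p S)) (closePremisses S k ls rs i?) → Derivable S
    sound′ (yes (Ls , Rs , pl , pr , ul , ur , app)) ds =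
      perm (applicable-sound app (All.map (derivable-extend [] [] S _ σ τ) ds)) (↭-sym σ) (↭-sym τ)
      where
        σ = catMaybes-eraseAll (left S) ul pl
        τ = catMaybes-eraseAll (right S) ur pr
    sound′ (no _) (d ∷ []) = derivable-extend [] [] S _ ↭-refl ↭-refl d

closePremisses-additions : ∀ {S k ls rs} (i? : Dec (Instance S k ls rs)) (i : Instance S k ls rs) →
                           closePremisses S k ls rs i? ≡ additions k (proj₁ i) (proj₁ (proj₂ i))
closePremisses-additions {S} {k} (yes (_ , _ , pl′ , pr′ , _)) (_ , _ , pl , pr , _) =
  cong₂ (additions k) (pointwise-functional (left S) pl′ pl) (pointwise-functional (right S) pr′ pr)
closePremisses-additions (no ¬i) i = ⊥-elim (¬i i)

persistentL-not-reduced : ∀ {S i φ ps} → PersistsL φ → left S [ i ]≡ φ → ¬ ReducesL S i ps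
persistentL-not-reduced {S} pφ e (_ , e′ , eq) with []≡-functional (left S) e e′
... | refl with trans (sym (pφ _ _)) eq
... | ()

persistentR-not-reduced : ∀ {S i ψ ps} → PersistsR ψ → right S [ i ]≡ ψ → ¬ ReducesR S i ps
persistentR-not-reduced {S} pψ e (_ , e′ , eq) with []≡-functional (right S) e e′
... | refl with trans (sym (pψ _ _)) eq
... | ()

module Search (em : ExcludedMiddle (lsuc 0ℓ)) where

  dec : (P : Set) → Dec P
  dec P with em {Lift (lsuc 0ℓ) P}
  ... | yes (lift p) = yes p
  ... | no ¬p        = no (¬p ∘ lift)

  step : Task → (S : State) → Step S
  step (reduceL i)          S = reduceLeft S i (left S ‼ i) refl
  step (reduceR i)          S = reduceRight S i (right S ‼ i) refl
  step (addNeighbourhood x) S = neighbourhoodStep S x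
  step (close k ls rs)      S = closeStep S k ls rs (dec _)

  reduceL-premisses : ∀ {S i φ ps} → left S [ i ]≡ φ → leftPremisses (freshW S) (freshN S) φ ≡ just ps →
                      premisses (step (reduceL i) S) ≡ ps
  reduceL-premisses {S} {i} {φ} {ps} e e′ = viaLookup (left S ‼ i) refl e
    where
      viaPremisses : ∀ e₀ m e₁ → m ≡ just ps → premisses (reduceLeftWith S i φ e₀ m e₁) ≡ ps
      viaPremisses _ _ _ refl = refl
      viaLookup : ∀ s (e₀ : left S ‼ i ≡ s) → s ≡ just (just φ) → premisses (reduceLeft S i s e₀) ≡ ps
      viaLookup _ e₀ refl = viaPremisses e₀ _ refl e′

  reduceR-premisses : ∀ {S i ψ ps} → right S [ i ]≡ ψ → rightPremisses (freshW S) (freshN S) ψ ≡ just ps →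
                      premisses (step (reduceR i) S) ≡ ps
  reduceR-premisses {S} {i} {ψ} {ps} e e′ = viaLookup (right S ‼ i) refl e
    where
      viaPremisses : ∀ e₀ m e₁ → m ≡ just ps → premisses (reduceRightWith S i ψ e₀ m e₁) ≡ ps
      viaPremisses _ _ _ refl = refl
      viaLookup : ∀ s (e₀ : right S ‼ i ≡ s) → s ≡ just (just ψ) → premisses (reduceRight S i s e₀) ≡ ps
      viaLookup _ e₀ refl = viaPremisses e₀ _ refl e′

  module Branch (S₀ : State) (¬d₀ : ¬ Derivable S₀) where

    refute : ∀ {S} (s : Step S) → ¬ Derivable S →
             ∃ λ p → p ∈ premisses s × ¬ Derivable (extend (erasedL s) (erasedR s) p S)
    refute s ¬d = find (¬All⇒Any¬ (λ _ → dec _) _ (¬d ∘ sound s))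

    branch : ℕ → Σ State (¬_ ∘ Derivable)
    branch zero    = S₀ , ¬d₀
    branch (suc m) =
      let S , ¬d      = branch m
          s           = step (task m) S
          p , _ , ¬d′ = refute s ¬d
      in  extend (erasedL s) (erasedR s) p S , ¬d′

    state : ℕ → State
    state m = proj₁ (branch m)

    stepAt : ∀ m → Step (state m)
    stepAt m = step (task m) (state m)

    InΓ InΔ : LF → Set
    InΓ φ = ∃₂ λ m i → left (state m) [ i ]≡ φ
    InΔ ψ = ∃₂ λ m i → right (state m) [ i ]≡ ψ

    Realised : List Premiss → Set
    Realised ps = ∃ λ p → p ∈ ps × All InΓ (proj₁ p) × All InΔ (proj₂ p)

    realised : ∀ m {ps} → premisses (stepAt m) ≡ ps → Realised ps
    realised m refl =
      let p , p∈ , _ = refute (stepAt m) (proj₂ (branch m))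
      in  p , p∈ , All.tabulate (λ φ∈ → suc m , appended-at (eraseAll (erasedL (stepAt m)) (left (state m))) φ∈)
                , All.tabulate (λ ψ∈ → suc m , appended-at (eraseAll (erasedR (stepAt m)) (right (state m))) ψ∈)

    survivesL : ∀ {m i φ} → left (state m) [ i ]≡ φ → i ∉ erasedL (stepAt m) → left (state (suc m)) [ i ]≡ φ
    survivesL {m} e i∉ = ‼-++ (eraseAll el (left (state m))) _ (trans (eraseAll-‼ el (left (state m)) i∉) e)
      where el = erasedL (stepAt m)

    survivesR : ∀ {m i ψ} → right (state m) [ i ]≡ ψ → i ∉ erasedR (stepAt m) → right (state (suc m)) [ i ]≡ ψ
    survivesR {m} e i∉ = ‼-++ (eraseAll er (right (state m))) _ (trans (eraseAll-‼ er (right (state m)) i∉) e)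
      where er = erasedR (stepAt m)

    persistsL-from : ∀ {m m′ i φ} → PersistsL φ → left (state m) [ i ]≡ φ → m ≤ m′ → left (state m′) [ i ]≡ φ
    persistsL-from {m} {i = i} {φ} pφ e = go ∘ ≤⇒≤′
      where
        go : ∀ {m′} → m ≤′ m′ → left (state m′) [ i ]≡ φ
        go (≤′-reflexive refl) = e
        go (≤′-step {n} le)    =
          survivesL {n} (go le) (persistentL-not-reduced {state n} pφ (go le) ∘ erasedL-reduces (stepAt n))

    persistsR-from : ∀ {m m′ i ψ} → PersistsR ψ → right (state m) [ i ]≡ ψ → m ≤ m′ → right (state m′) [ i ]≡ ψ
    persistsR-from {m} {i = i} {ψ} pψ e = go ∘ ≤⇒≤′
      where
        go : ∀ {m′} → m ≤′ m′ → right (state m′) [ i ]≡ ψ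
        go (≤′-reflexive refl) = e
        go (≤′-step {n} le)    =
          survivesR {n} (go le) (persistentR-not-reduced {state n} pψ (go le) ∘ erasedR-reduces (stepAt n))

    reducedΓ : ∀ {φ} → InΓ φ → (∀ y n → ∃ λ ps → leftPremisses y n φ ≡ just ps) →
               ∃₂ λ y n → ∃ λ ps → leftPremisses y n φ ≡ just ps × Realised ps
    reducedΓ {φ} (m , i , e) consumable =
      let m₁ , m≤m₁ , tk = task-infinitely-often (reduceL i) m
          o , m+o≡m₁    = m≤n⇒∃[o]m+o≡n m≤m₁
      in  walk o e (subst (λ k → task k ≡ reduceL i) (sym (trans (+-comm o m) m+o≡m₁)) tk)
      where
        walk : ∀ o {m} → left (state m) [ i ]≡ φ → task (o + m) ≡ reduceL i →
               ∃₂ λ y n → ∃ λ ps → leftPremisses y n φ ≡ just ps × Realised ps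
        walk zero {m} e tk =
          let ps , eq = consumable (freshW (state m)) (freshN (state m))
          in  _ , _ , ps , eq ,
              realised m (trans (cong (λ t → premisses (step t (state m))) tk) (reduceL-premisses {state m} e eq))
        walk (suc o) {m} e tk with i ∈? erasedL (stepAt m)
        ... | no i∉ = walk o (survivesL {m} e i∉) (subst (λ k → task k ≡ reduceL i) (sym (+-suc o m)) tk)
        ... | yes i∈ with erasedL-reduces (stepAt m) i∈
        ...   | _ , e′ , eq with []≡-functional (left (state m)) e e′
        ...     | refl = _ , _ , _ , eq , realised m refl

    reducedΔ : ∀ {ψ} → InΔ ψ → (∀ y n → ∃ λ ps → rightPremisses y n ψ ≡ just ps) →
               ∃₂ λ y n → ∃ λ ps → rightPremisses y n ψ ≡ just ps × Realised ps
    reducedΔ {ψ} (m , i , e) consumable =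
      let m₁ , m≤m₁ , tk = task-infinitely-often (reduceR i) m
          o , m+o≡m₁    = m≤n⇒∃[o]m+o≡n m≤m₁
      in  walk o e (subst (λ k → task k ≡ reduceR i) (sym (trans (+-comm o m) m+o≡m₁)) tk)
      where
        walk : ∀ o {m} → right (state m) [ i ]≡ ψ → task (o + m) ≡ reduceR i →
               ∃₂ λ y n → ∃ λ ps → rightPremisses y n ψ ≡ just ps × Realised ps
        walk zero {m} e tk =
          let ps , eq = consumable (freshW (state m)) (freshN (state m))
          in  _ , _ , ps , eq ,
              realised m (trans (cong (λ t → premisses (step t (state m))) tk) (reduceR-premisses {state m} e eq))
        walk (suc o) {m} e tk with i ∈? erasedR (stepAt m)
        ... | no i∉ = walk o (survivesR {m} e i∉) (subst (λ k → task k ≡ reduceR i) (sym (+-suc o m)) tk)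
        ... | yes i∈ with erasedR-reduces (stepAt m) i∈
        ...   | _ , e′ , eq with []≡-functional (right (state m)) e e′
        ...     | refl = _ , _ , _ , eq , realised m refl

    stablyΓ : ∀ {Φ} → All PersistsL Φ → All InΓ Φ →
              ∃₂ λ m₀ is → ∀ {m} → m₀ ≤ m → Pointwise (left (state m) [_]≡_) is Φ
    stablyΓ []         []                    = 0 , [] , λ _ → []
    stablyΓ (pφ ∷ pΦ) ((m₁ , i , e) ∷ inΦ) =
      let m₀ , is , pw = stablyΓ pΦ inΦ
      in  m₁ ⊔ m₀ , i ∷ is ,
          λ {m} le → persistsL-from {m₁} {m} pφ e (≤-trans (m≤m⊔n m₁ m₀) le) ∷ pw (≤-trans (m≤n⊔m m₁ m₀) le)

    stablyΔ : ∀ {Ψ} → All PersistsR Ψ → All InΔ Ψ →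
              ∃₂ λ m₀ is → ∀ {m} → m₀ ≤ m → Pointwise (right (state m) [_]≡_) is Ψ
    stablyΔ []         []                    = 0 , [] , λ _ → []
    stablyΔ (pψ ∷ pΨ) ((m₁ , i , e) ∷ inΨ) =
      let m₀ , is , pw = stablyΔ pΨ inΨ
      in  m₁ ⊔ m₀ , i ∷ is ,
          λ {m} le → persistsR-from {m₁} {m} pψ e (≤-trans (m≤m⊔n m₁ m₀) le) ∷ pw (≤-trans (m≤n⊔m m₁ m₀) le)

    closed : ∀ {k Ls Rs} → Applicable k Ls Rs → Unique Ls → Unique Rs → All InΓ Ls → All InΔ Rs →
             Realised (additions k Ls Rs)
    closed {k} app uL uR inL inR =
      let pL , pR        = applicable-persists app
          mL , ls , pwL  = stablyΓ pL inL
          mR , rs , pwR  = stablyΔ pR inR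
          m , m₀≤m , tk  = task-infinitely-often (close k ls rs) (mL ⊔ mR)
          pl             = pwL (≤-trans (m≤m⊔n mL mR) m₀≤m)
          pr             = pwR (≤-trans (m≤n⊔m mL mR) m₀≤m)
          inst           = _ , _ , pl , pr , positions-unique (left (state m)) uL pl ,
                           positions-unique (right (state m)) uR pr , app
      in  realised m (trans (cong (λ t → premisses (step t (state m))) tk) (closePremisses-additions (dec _) inst))

    not-axiom : ∀ {x p} → InΓ (x ∶ atom p) → InΔ (x ∶ atom p) → ⊥
    not-axiom (m₁ , i , e₁) (m₂ , j , e₂) =
      proj₂ (branch m) (perm init (↭-sym (catMaybes-erase (left (state m)) eΓ))
                                  (↭-sym (catMaybes-erase (right (state m)) eΔ)))
      where
        m  = m₁ ⊔ m₂
        eΓ = persistsL-from {m₁} {m} (λ _ _ → refl) e₁ (m≤m⊔n m₁ m₂)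
        eΔ = persistsR-from {m₂} {m} (λ _ _ → refl) e₂ (m≤n⊔m m₁ m₂)

    not-⊥ : ∀ {x} → ¬ InΓ (x ∶ ⊥')
    not-⊥ (m , i , e) = proj₂ (branch m) (perm init⊥ (↭-sym (catMaybes-erase (left (state m)) e)) ↭-refl)

    Γ-∧ : ∀ {x A B} → InΓ (x ∶ (A ∧' B)) → InΓ (x ∶ A) × InΓ (x ∶ B)
    Γ-∧ h with reducedΓ h (λ _ _ → _ , refl)
    ... | _ , _ , _ , refl , _ , here refl , a ∷ b ∷ [] , [] = a , b

    Γ-∨ : ∀ {x A B} → InΓ (x ∶ (A ∨' B)) → InΓ (x ∶ A) ⊎ InΓ (x ∶ B)
    Γ-∨ h with reducedΓ h (λ _ _ → _ , refl)
    ... | _ , _ , _ , refl , _ , here refl         , a ∷ [] , [] = inj₁ a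
    ... | _ , _ , _ , refl , _ , there (here refl) , b ∷ [] , [] = inj₂ b

    Γ-⇒ : ∀ {x A B} → InΓ (x ∶ (A ⇒' B)) → InΔ (x ∶ A) ⊎ InΓ (x ∶ B)
    Γ-⇒ h with reducedΓ h (λ _ _ → _ , refl)
    ... | _ , _ , _ , refl , _ , here refl         , [] , a ∷ [] = inj₁ a
    ... | _ , _ , _ , refl , _ , there (here refl) , b ∷ [] , [] = inj₂ b

    Γ-∃ : ∀ {a A} → InΓ (a ⊩∃ A) → ∃ λ y → InΓ (y ∈ₗ a) × InΓ (y ∶ A)
    Γ-∃ h with reducedΓ h (λ _ _ → _ , refl)
    ... | _ , _ , _ , refl , _ , here refl , y∈a ∷ yA ∷ [] , [] = _ , y∈a , yA

    Γ-∣ : ∀ {x a A B} → InΓ (x ⊩[ a ] A ∣ B) →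
          ∃ λ n → InΓ (nb n ∈N x) × InΓ (nb n ⊆ₗ a) × InΓ (nb n ⊩∃ A) × InΓ (nb n ⊩∀ (A ⇒' B))
    Γ-∣ h with reducedΓ h (λ _ _ → _ , refl)
    ... | _ , _ , _ , refl , _ , here refl , cN ∷ c⊆a ∷ c∃ ∷ c∀ ∷ [] , [] = _ , cN , c⊆a , c∃ , c∀

    Δ-∧ : ∀ {x A B} → InΔ (x ∶ (A ∧' B)) → InΔ (x ∶ A) ⊎ InΔ (x ∶ B)
    Δ-∧ h with reducedΔ h (λ _ _ → _ , refl)
    ... | _ , _ , _ , refl , _ , here refl         , [] , a ∷ [] = inj₁ a
    ... | _ , _ , _ , refl , _ , there (here refl) , [] , b ∷ [] = inj₂ b

    Δ-∨ : ∀ {x A B} → InΔ (x ∶ (A ∨' B)) → InΔ (x ∶ A) × InΔ (x ∶ B)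
    Δ-∨ h with reducedΔ h (λ _ _ → _ , refl)
    ... | _ , _ , _ , refl , _ , here refl , [] , a ∷ b ∷ [] = a , b

    Δ-⇒ : ∀ {x A B} → InΔ (x ∶ (A ⇒' B)) → InΓ (x ∶ A) × InΔ (x ∶ B)
    Δ-⇒ h with reducedΔ h (λ _ _ → _ , refl)
    ... | _ , _ , _ , refl , _ , here refl , a ∷ [] , b ∷ [] = a , b

    Δ-∀ : ∀ {a A} → InΔ (a ⊩∀ A) → ∃ λ y → InΓ (y ∈ₗ a) × InΔ (y ∶ A)
    Δ-∀ h with reducedΔ h (λ _ _ → _ , refl)
    ... | _ , _ , _ , refl , _ , here refl , y∈a ∷ [] , yA ∷ [] = _ , y∈a , yA

    Δ-> : ∀ {x A B} → InΔ (x ∶ (A >' B)) →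
          ∃ λ n → InΓ (nb n ∈N x) × InΓ (nb n ⊩∃ A) × InΔ (x ⊩[ nb n ] A ∣ B)
    Δ-> h with reducedΔ h (λ _ _ → _ , refl)
    ... | _ , _ , _ , refl , _ , here refl , cN ∷ c∃ ∷ [] , c∣ ∷ [] = _ , cN , c∃ , c∣

    Γ-∀ : ∀ {x a A} → InΓ (x ∈ₗ a) → InΓ (a ⊩∀ A) → InΓ (x ∶ A)
    Γ-∀ h₁ h₂ with closed L∀ (unique₂ λ ()) [] (h₁ ∷ h₂ ∷ []) []
    ... | _ , here refl , a ∷ [] , [] = a

    Δ-∃ : ∀ {x a A} → InΓ (x ∈ₗ a) → InΔ (a ⊩∃ A) → InΔ (x ∶ A)
    Δ-∃ h₁ h₂ with closed R∃ unique₁ unique₁ (h₁ ∷ []) (h₂ ∷ [])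
    ... | _ , here refl , [] , a ∷ [] = a

    Γ-> : ∀ {x a A B} → InΓ (a ∈N x) → InΓ (x ∶ (A >' B)) → InΔ (a ⊩∃ A) ⊎ InΓ (x ⊩[ a ] A ∣ B)
    Γ-> h₁ h₂ with closed L> (unique₂ λ ()) [] (h₁ ∷ h₂ ∷ []) []
    ... | _ , here refl         , [] , a ∷ [] = inj₁ a
    ... | _ , there (here refl) , b ∷ [] , [] = inj₂ b

    Δ-∣ : ∀ {x a c A B} → InΓ (c ∈N x) → InΓ (c ⊆ₗ a) → InΔ (x ⊩[ a ] A ∣ B) →
          InΔ (c ⊩∃ A) ⊎ InΔ (c ⊩∀ (A ⇒' B))
    Δ-∣ h₁ h₂ h₃ with closed R∣ (unique₂ λ ()) unique₁ (h₁ ∷ h₂ ∷ []) (h₃ ∷ [])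
    ... | _ , here refl         , [] , a ∷ [] = inj₁ a
    ... | _ , there (here refl) , [] , b ∷ [] = inj₂ b

    Γ-⊆-trans : ∀ {a b c} → InΓ (c ⊆ₗ b) → InΓ (b ⊆ₗ a) → InΓ (c ⊆ₗ a)
    Γ-⊆-trans {a} {b} {c} h₁ h₂ with dec ((c ⊆ₗ b) ≡ (b ⊆ₗ a))
    ... | yes refl = h₁
    ... | no c⊆b≢b⊆a with closed Tr (unique₂ c⊆b≢b⊆a) [] (h₁ ∷ h₂ ∷ []) []
    ...   | _ , here refl , a ∷ [] , [] = a

    Γ-∈-⊆ : ∀ {x a b} → InΓ (x ∈ₗ a) → InΓ (a ⊆ₗ b) → InΓ (x ∈ₗ b)
    Γ-∈-⊆ h₁ h₂ with closed L⊆ (unique₂ λ ()) [] (h₁ ∷ h₂ ∷ []) []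
    ... | _ , here refl , a ∷ [] , [] = a

    Γ-ref : ∀ {a x} → InΓ (a ∈N x) → InΓ (a ⊆ₗ a)
    Γ-ref h with closed Ref unique₁ [] (h ∷ []) []
    ... | _ , here refl , a ∷ [] , [] = a

    Γ-W : ∀ {a x} → InΓ (a ∈N x) → InΓ (x ∈ₗ a)
    Γ-W h with closed W unique₁ [] (h ∷ []) []
    ... | _ , here refl , a ∷ [] , [] = a

    Γ-C : ∀ {a x} → InΓ (a ∈N x) → InΓ (sing x ∈N x) × InΓ (sing x ⊆ₗ a)
    Γ-C h with closed C unique₁ [] (h ∷ []) []
    ... | _ , here refl , a ∷ b ∷ [] , [] = a , b

    Γ-single : ∀ {x} → InΓ (sing x ∈N x) → InΓ (x ∈ₗ sing x)
    Γ-single h with closed Single unique₁ [] (h ∷ []) []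
    ... | _ , here refl , a ∷ [] , [] = a

    Γ-N : ∀ x → ∃ λ n → InΓ (nb n ∈N x)
    Γ-N x with task-infinitely-often (addNeighbourhood x) 0
    ... | m , _ , tk with realised m (cong (λ t → premisses (step t (state m))) tk)
    ...   | _ , here refl , a ∷ [] , [] = _ , a

    Γ-sing-∈N : ∀ x → InΓ (sing x ∈N x)
    Γ-sing-∈N x = proj₁ (Γ-C (proj₂ (Γ-N x)))

    Γ-∈-sing : ∀ x → InΓ (x ∈ₗ sing x)
    Γ-∈-sing x = Γ-single (Γ-sing-∈N x)

    Γ-repl₁ : ∀ t {x y} → InΓ (y ∈ₗ sing x) → InΓ (at t x) → InΓ (at t y)
    Γ-repl₁ t {x} {y} h₁ h₂ with dec ((y ∈ₗ sing x) ≡ at t x)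
    ... | yes e = subst (λ z → InΓ (at t z)) (sym (sing≡at⇒≡ t e)) h₂
    ... | no ne with closed (Repl₁ t) (unique₂ ne) [] (h₁ ∷ h₂ ∷ []) []
    ...   | _ , here refl , a ∷ [] , [] = subst InΓ (moveTo-at t) a

    Γ-repl₂ : ∀ t {x y} → InΓ (y ∈ₗ sing x) → InΓ (at t y) → InΓ (at t x)
    Γ-repl₂ t {x} {y} h₁ h₂ with dec ((y ∈ₗ sing x) ≡ at t y)
    ... | yes e = subst InΓ (sym (sing≡at⇒at≡sing t e)) (Γ-∈-sing x)
    ... | no ne with closed (Repl₂ t) (unique₂ ne) [] (h₁ ∷ h₂ ∷ []) []
    ...   | _ , here refl , a ∷ [] , [] = subst InΓ (moveTo-at t) a

least : (P : ℕ → Set) → (∀ k → Dec (P k)) → ∀ n → P n → ∃ λ k → P k × (∀ j → P j → k ≤ j)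
least P P? zero    p = 0 , p , λ _ _ → z≤n
least P P? (suc n) p with P? zero
... | yes p₀ = 0 , p₀ , λ _ _ → z≤n
... | no ¬p₀ =
  let k , pk , minimal = least (P ∘ suc) (P? ∘ suc) n p
  in  suc k , pk , λ { zero p₀ → ⊥-elim (¬p₀ p₀) ; (suc j) pj → s≤s (minimal j pj) }

module Countermodel (em : ExcludedMiddle (lsuc 0ℓ)) (S₀ : State) (¬d₀ : ¬ Derivable S₀) where
  open Search em
  open Branch S₀ ¬d₀

  _~_ : WL → WL → Set
  y ~ x = InΓ (y ∈ₗ sing x)

  ~-refl : ∀ x → x ~ x
  ~-refl = Γ-∈-sing

  ~-sym : ∀ {x y} → y ~ x → x ~ y
  ~-sym {y = y} h = Γ-repl₂ (atSing y) h (~-refl y)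

  ~-trans : ∀ {x y z} → z ~ y → y ~ x → z ~ x
  ~-trans {x} h₁ h₂ = Γ-repl₁ (atSing x) h₁ h₂

  opaque
    representative : ∀ y → ∃ λ r → y ~ r × (∀ j → y ~ j → r ≤ j)
    representative y = least (y ~_) (λ _ → dec _) y (~-refl y)

  rep : WL → WL
  rep y = proj₁ (representative y)

  rep-~ : ∀ y → y ~ rep y
  rep-~ y = proj₁ (proj₂ (representative y))

  rep-cong : ∀ {y y′} → y ~ y′ → rep y ≡ rep y′
  rep-cong {y} {y′} h = ≤-antisym (proj₂ (proj₂ (representative y)) _ (~-trans h (rep-~ y′)))
                                  (proj₂ (proj₂ (representative y′)) _ (~-trans (~-sym h) (rep-~ y)))

  rep-idem : ∀ y → rep (rep y) ≡ rep y
  rep-idem y = rep-cong (~-sym (rep-~ y))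

  rep-injective : ∀ {v w} → rep v ≡ v → rep w ≡ w → v ~ w → v ≡ w
  rep-injective rv rw h = trans (sym rv) (trans (rep-cong h) rw)

  World : Set
  World = WL × Maybe NL

  -- The tags make inclusion
  -- of neighbourhoods reflect inclusion of their labels (see tagged-⊆).
  nbhd : World → NL → World → Set
  nbhd (w , k) a (v , j) =
    (v ≡ w × j ≡ k) ⊎
    (v ≢ w × rep v ≡ v × InΓ (v ∈ₗ a) × (j ≡ nothing ⊎ ∃ λ c → j ≡ just c × InΓ (v ∈ₗ c) × InΓ (c ⊆ₗ a)))

  Nbhds : World → (World → Set) → Set
  Nbhds (w , k) α =
    (rep w ≡ w × ∃ λ a → InΓ (a ∈N w) × α ≐′ nbhd (w , k) a) ⊎ (rep w ≢ w × α ≐′ (_≡ (w , k)))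

  centred : ∀ u α → Nbhds u α → α u
  centred (w , k) α (inj₁ (_ , _ , _ , α≐)) = proj₂ α≐ (w , k) (inj₁ (refl , refl))
  centred (w , k) α (inj₂ (_ , α≐))         = proj₂ α≐ (w , k) refl

  nbhd-sing : ∀ {w k u} → rep w ≡ w → nbhd (w , k) (sing w) u → u ≡ (w , k)
  nbhd-sing r (inj₁ (refl , refl))       = refl
  nbhd-sing r (inj₂ (v≢w , rv , v~w , _)) = ⊥-elim (v≢w (rep-injective rv r v~w))

  singleton-nbhd : ∀ u → Nbhds u (_≡ u)
  singleton-nbhd (w , k) with rep w ≟ w
  ... | yes r = inj₁ (r , sing w , Γ-sing-∈N w , (λ { _ refl → inj₁ (refl , refl) }) , (λ _ → nbhd-sing r))
  ... | no ¬r = inj₂ (¬r , (λ _ e → e) , (λ _ e → e))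

  model : NModel
  model = record
    { W = World ; inhabited = 0 , nothing ; N = Nbhds ; nonempty = λ u α h → u , centred u α h
    ; V = λ p u → InΓ (proj₁ u ∶ atom p) }

  model-centered : Centered model
  model-centered = centred , singleton-nbhd

  nbhd-⊆ : ∀ {u c a v} → nbhd u c v → InΓ (c ⊆ₗ a) → nbhd u a v
  nbhd-⊆ (inj₁ e) _ = inj₁ e
  nbhd-⊆ (inj₂ (v≢w , rv , v∈c , inj₁ e)) c⊆a = inj₂ (v≢w , rv , Γ-∈-⊆ v∈c c⊆a , inj₁ e)
  nbhd-⊆ (inj₂ (v≢w , rv , v∈c , inj₂ (d , e , v∈d , d⊆c))) c⊆a =
    inj₂ (v≢w , rv , Γ-∈-⊆ v∈c c⊆a , inj₂ (d , e , v∈d , Γ-⊆-trans d⊆c c⊆a))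

  nbhd-∋ : ∀ {w k c z} → InΓ (z ∈ₗ c) → ∃ λ j → nbhd (w , k) c (rep z , j)
  nbhd-∋ {w} {k} {c} {z} h with rep z ≟ w
  ... | yes e = k , inj₁ (e , refl)
  ... | no ne = nothing , inj₂ (ne , rep-idem z , Γ-repl₂ (atIn c) (rep-~ z) h , inj₁ refl)

  nbhd-∈ : ∀ {w k c v j} → rep w ≡ w → InΓ (c ∈N w) → nbhd (w , k) c (v , j) → ∃ λ l → InΓ (l ∈ₗ c) × v ≡ rep l
  nbhd-∈ {w} r cN (inj₁ (refl , refl))     = w , Γ-W cN , sym r
  nbhd-∈ r cN (inj₂ (_ , rv , v∈c , _)) = _ , v∈c , sym rv

  tagged-⊆ : ∀ {w k v c a x} → InΓ (c ∈N x) → rep v ≡ v → v ≢ w → InΓ (v ∈ₗ c) →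
             (∀ u → nbhd (w , k) c u → nbhd (w , k) a u) → InΓ (c ⊆ₗ a)
  tagged-⊆ {c = c} cN rv v≢w v∈c incl with incl _ (inj₂ (v≢w , rv , v∈c , inj₂ (c , refl , v∈c , Γ-ref cN)))
  ... | inj₁ (v≡w , _)                         = ⊥-elim (v≢w v≡w)
  ... | inj₂ (_ , _ , _ , inj₂ (_ , refl , _ , c⊆a)) = c⊆a

  centre-only : ∀ {w k c u} → (∀ v → rep v ≡ v → v ≢ w → ¬ InΓ (v ∈ₗ c)) → nbhd (w , k) c u → u ≡ (w , k)
  centre-only none (inj₁ (refl , refl))         = refl
  centre-only none (inj₂ (v≢w , rv , v∈c , _)) = ⊥-elim (none _ rv v≢w v∈c)

  infix 4 _⊨_
  _⊨_ : World → Fm → Set₁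
  u ⊨ A = _⊩_ model u A

  TrueΓ FalseΔ : Fm → Set₁
  TrueΓ  A = ∀ y j → InΓ (y ∶ A) → (rep y , j) ⊨ A
  FalseΔ A = ∀ y j → InΔ (y ∶ A) → ¬ (rep y , j) ⊨ A

  ∃-false : ∀ {A w k a} → FalseΔ A → rep w ≡ w → InΓ (a ∈N w) → InΔ (a ⊩∃ A) →
            ∀ u → nbhd (w , k) a u → ¬ u ⊨ A
  ∃-false fA r aN h (v , j) m uA with nbhd-∈ r aN m
  ... | l , l∈a , refl = fA l j (Δ-∃ l∈a h) uA

  ∃-true : ∀ {A w k c} → TrueΓ A → InΓ (c ⊩∃ A) → ∃ λ u → nbhd (w , k) c u × u ⊨ A
  ∃-true tA h =
    let z , z∈c , zA = Γ-∃ h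
        j , m        = nbhd-∋ z∈c
    in  (rep z , j) , m , tA z j zA

  ∀-true : ∀ {A B w k c} → FalseΔ A → TrueΓ B → rep w ≡ w → InΓ (c ∈N w) → InΓ (c ⊩∀ (A ⇒' B)) →
           ∀ u → nbhd (w , k) c u → u ⊨ A → u ⊨ B
  ∀-true fA tB r cN h (v , j) m uA with nbhd-∈ r cN m
  ... | l , l∈c , refl = [ (λ lA → ⊥-elim (fA l j lA uA)) , tB l j ]′ (Γ-⇒ (Γ-∀ l∈c h))

  ∀-false : ∀ {A B w k c} → TrueΓ A → FalseΔ B → InΔ (c ⊩∀ (A ⇒' B)) →
            ∃ λ u → nbhd (w , k) c u × u ⊨ A × ¬ u ⊨ B
  ∀-false tA fB h =
    let z , z∈c , zAB = Δ-∀ h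
        zA , zB       = Δ-⇒ zAB
        j , m         = nbhd-∋ z∈c
    in  (rep z , j) , m , tA z j zA , fB z j zB

  ∣-false : ∀ {A B y k a d} → TrueΓ A → FalseΔ A → FalseΔ B → InΔ (y ⊩[ a ] A ∣ B) →
            InΓ (d ∈N rep y) → InΓ (d ⊆ₗ a) → (∃ λ u → nbhd (rep y , k) d u × u ⊨ A) →
            (∀ u → nbhd (rep y , k) d u → u ⊨ A → u ⊨ B) → ⊥
  ∣-false {y = y} tA fA fB h dN d⊆a (u , m , uA) dAB =
    [ (λ d∃ → ∃-false fA (rep-idem y) dN d∃ u m uA)
    , (λ d∀ → let u′ , m′ , u′A , ¬u′B = ∀-false tA fB d∀ in ¬u′B (dAB u′ m′ u′A))
    ]′ (Δ-∣ (Γ-repl₁ (atN _) (rep-~ y) dN) d⊆a h)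

  -- The witness demanded by the forcing clause of A >' B for the neighbourhood α of u.
  Shrinks : World → (World → Set) → Fm → Fm → Set₁
  Shrinks u α A B = Σ (World → Set) λ β →
    Nbhds u β × (∀ v → β v → α v) × (∃ λ v → β v × v ⊨ A) × (∀ v → β v → v ⊨ A → v ⊨ B)

  >-true : ∀ {A B} → TrueΓ A → FalseΔ A → TrueΓ B → TrueΓ (A >' B)
  >-true tA fA tB y k h α (inj₂ (¬r , _)) _ = ⊥-elim (¬r (rep-idem y))
  >-true {A} {B} tA fA tB y k h α (inj₁ (_ , a , aN , α≐)) (u₀ , α∋u₀ , u₀A) =
    [ (λ a∃ → ⊥-elim (∃-false fA (rep-idem y) aN a∃ u₀ (proj₁ α≐ u₀ α∋u₀) u₀A)) , inner ]′
    (Γ-> (Γ-repl₁ (atN a) (rep-~ y) aN) h)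
    where
      inner : InΓ (y ⊩[ a ] A ∣ B) → Shrinks (rep y , k) α A B
      inner y∣ =
        let n , nN , n⊆a , n∃ , n∀ = Γ-∣ y∣
            nN′                    = Γ-repl₂ (atN (nb n)) (rep-~ y) nN
        in  nbhd (rep y , k) (nb n) , inj₁ (rep-idem y , nb n , nN′ , (λ _ z → z) , (λ _ z → z)) ,
            (λ u m → proj₂ α≐ u (nbhd-⊆ m n⊆a)) , ∃-true tA n∃ , ∀-true fA tB (rep-idem y) nN′ n∀

  >-false : ∀ {A B} → TrueΓ A → FalseΔ A → FalseΔ B → FalseΔ (A >' B)
  >-false {A} {B} tA fA fB y k h H =
    let n , nN , n∃ , n∣ = Δ-> h
        nN′               = Γ-repl₂ (atN (nb n)) (rep-~ y) nN
    in  no-shrink n∣ nN′ (H (nbhd (rep y , k) (nb n)) (inj₁ (rep-idem y , nb n , nN′ , (λ _ z → z) , (λ _ z → z)))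
                            (∃-true tA n∃))
    where
      -- β is the neighbourhood of some label c ∈ N(rep y).  Either c has a member other than rep y,
      -- whose c-tagged copy shows c ⊆ n, or β = {rep y} and the rule C gives {rep y} ⊆ n.
      no-shrink : ∀ {n} → InΔ (y ⊩[ nb n ] A ∣ B) → InΓ (nb n ∈N rep y) →
                  ¬ Shrinks (rep y , k) (nbhd (rep y , k) (nb n)) A B
      no-shrink n∣ nN (_ , inj₂ (¬r , _) , _) = ¬r (rep-idem y)
      no-shrink n∣ nN (β , inj₁ (_ , c , cN , β≐) , β⊆ , (u₁ , β∋u₁ , u₁A) , βAB) = by-cases (dec _)
        where
          by-cases : Dec (∃ λ v → rep v ≡ v × v ≢ rep y × InΓ (v ∈ₗ c)) → ⊥
          by-cases (yes (v , rv , v≢ , v∈c)) =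
            ∣-false tA fA fB n∣ cN (tagged-⊆ cN rv v≢ v∈c (λ u m → β⊆ u (proj₂ β≐ u m)))
                    (u₁ , proj₁ β≐ u₁ β∋u₁ , u₁A) (λ u m → βAB u (proj₂ β≐ u m))
          by-cases (no none) =
            ∣-false tA fA fB n∣ sN s⊆n (_ , inj₁ (refl , refl) , subst (_⊨ A) u₁≡ u₁A)
                    (λ u m → βAB u (subst β (sym (nbhd-sing (rep-idem y) m)) (proj₂ β≐ _ (inj₁ (refl , refl)))))
            where
              u₁≡ = centre-only (λ v rv v≢ v∈c → none (v , rv , v≢ , v∈c)) (proj₁ β≐ u₁ β∋u₁)
              sN  = proj₁ (Γ-C nN)
              s⊆n = proj₂ (Γ-C nN)

  truth : ∀ A → TrueΓ A × FalseΔ A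
  truth (atom p) =
    (λ y j h → lift (Γ-repl₂ (atP p) (rep-~ y) h)) ,
    (λ y j h uA → not-axiom (Γ-repl₁ (atP p) (rep-~ y) (lower uA)) h)
  truth ⊥'       = (λ y j h → ⊥-elim (not-⊥ h)) , (λ y j h → lower)
  truth (A ∧' B) =
    let tA , fA = truth A ; tB , fB = truth B
    in  (λ y j h → let a , b = Γ-∧ h in tA y j a , tB y j b)
      , (λ y j h (uA , uB) → [ (λ a → fA y j a uA) , (λ b → fB y j b uB) ]′ (Δ-∧ h))
  truth (A ∨' B) =
    let tA , fA = truth A ; tB , fB = truth B
    in  (λ y j h → Sum.map (tA y j) (tB y j) (Γ-∨ h))
      , (λ y j h → let a , b = Δ-∨ h in [ fA y j a , fB y j b ]′)
  truth (A ⇒' B) =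
    let tA , fA = truth A ; tB , fB = truth B
    in  (λ y j h uA → [ (λ a → ⊥-elim (fA y j a uA)) , tB y j ]′ (Γ-⇒ h))
      , (λ y j h u⊨ → let a , b = Δ-⇒ h in fB y j b (u⊨ (tA y j a)))
  truth (A >' B) =
    let tA , fA = truth A ; tB , fB = truth B
    in  >-true tA fA tB , >-false tA fA fB

  refutes : ∀ {x A} → InΔ (x ∶ A) → ¬ ValidC A
  refutes {x} {A} h valid = proj₂ (truth A) x nothing h (valid model model-centered (rep x , nothing))

mainTheorem16 : ExcludedMiddle (lsuc 0ℓ) →
    (A : Fm) → ValidC A → (x : WL) → [] ⇒ [ x ∶ A ]
mainTheorem16 em A valid x with Search.dec em ([] ⇒ [ x ∶ A ])
... | yes d  = d
... | no ¬d = ⊥-elim (Countermodel.refutes em ([] ⊢ [ just (x ∶ A) ]) ¬d (0 , 0 , refl) valid)
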